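{- Let $t, k$ be positive integers, let $n > (2k-1)t$ with $kt < n$, and let $G = G_n\langle t, 2t, \ldots, kt\rangle$. Then $$\theta_v(G) = s\left\lceil \frac{\lceil n/t\rceil}{k+1}\right\rceil + (t-s)\left\lceil \frac{\lfloor n/t\rfloor}{k+1}\right\rceil,$$ where $s$ is the integer with $s \equiv n \pmod t$ and $1 \le s \le t$.
   Context: For integers $1 \le t_1 < \cdots < t_k < n$, the Toeplitz graph $G_n\langle t_1, \ldots, t_k\rangle$ is the simple graph with vertex set $\{1, \ldots, n\}$ in which distinct vertices $i,j$ are adjacent iff $|i-j| \in \{t_1, \ldots, t_k\}$. A clique cover of a graph is a set of cliques such that every vertex lies in at least one of them; $\theta_v(G)$ is the minimum size of a clique cover. -}

module Defs where

open import Data.Nat using (ℕ; suc; _+_; _*_; _∸_; _≤_; _<_; ∣_-_∣; NonZero)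
open import Data.Nat.DivMod using (_/_)
open import Data.List using (List; map; upTo; length)
open import Data.List.Membership.Propositional using (_∈_)
open import Data.List.Relation.Unary.All using (All)
open import Data.List.Relation.Unary.Any using (Any)
open import Data.Product using (_×_)
open import Relation.Binary.PropositionalEquality using (_≢_)

Vertex : ℕ → ℕ → Set
Vertex n i = 1 ≤ i × i ≤ n

ToeplitzAdj : List ℕ → ℕ → ℕ → Set
ToeplitzAdj T i j = i ≢ j × ∣ i - j ∣ ∈ T

multiples : ℕ → ℕ → List ℕ
multiples t k = map (λ j → suc j * t) (upTo k)

IsClique : ℕ → List ℕ → List ℕ → Set
IsClique n T C = All (Vertex n) C × (∀ {x y} → x ∈ C → y ∈ C → x ≢ y → ToeplitzAdj T x y)

IsCliqueCover : ℕ → List ℕ → List (List ℕ) → Set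
IsCliqueCover n T 𝒞 = All (IsClique n T) 𝒞 × (∀ v → Vertex n v → Any (v ∈_) 𝒞)

ThetaV : ℕ → List ℕ → ℕ → Set
ThetaV n T m = (Data.Product.Σ (List (List ℕ)) λ 𝒞 → IsCliqueCover n T 𝒞 × length 𝒞 ≡ m)
             × (∀ 𝒞 → IsCliqueCover n T 𝒞 → m ≤ length 𝒞)
  where open import Relation.Binary.PropositionalEquality using (_≡_)

ceilDiv : (a b : ℕ) → .{{NonZero b}} → ℕ
ceilDiv a b = (a + (b ∸ 1)) / b

{-# OPTIONS --safe #-}
-- The vertices congruent to r + 1 modulo t form a column, inside which G is the k-th power of
-- a path, and vertices of different columns are never adjacent. In each column the vertices in
-- rows 0, k + 1, 2(k + 1), … are pairwise non-adjacent, while the windows of k + 1 consecutive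
-- rows starting at them are cliques covering the column. So θ_v is the number of these
-- witnesses, ⌈c / (k + 1)⌉ summed over the column sizes c, which are ⌈n / t⌉ for the first s
-- columns and ⌊n / t⌋ for the other t − s.
module Submission where

open import Defs
open import Data.Nat using (ℕ; zero; suc; _+_; _*_; _∸_; _≤_; _<_; NonZero; >-nonZero; z≤n; s≤s; ∣_-_∣)
open import Data.Nat.Properties
open import Data.Nat.DivMod using (_/_; _%_; m≡m%n+[m/n]*n; m%n<n; [m+kn]%n≡m%n; m<n⇒m%n≡m; m*n%n≡0; n%n≡0; m*n/n≡m; m/n*n≤m; /-monoˡ-≤; m<n⇒m/n≡0; +-distrib-/; m/n≡1+[m∸n]/n)
open import Data.Nat.Tactic.RingSolver using (solve-∀)
open import Data.Fin using (Fin)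
open import Data.Fin.Properties using (injective⇒≤)
open import Data.List using (List; []; _∷_; map; length; concatMap; downFrom; lookup; filter)
open import Data.Nat.ListAction using (sum)
open import Data.List.Properties using (length-++; length-map; length-downFrom)
open import Data.List.Membership.Propositional using (_∈_; find; lose)
open import Data.List.Membership.Propositional.Properties using (∈-lookup; ∈-map⁺; ∈-map⁻; ∈-upTo⁺; ∈-upTo⁻; ∈-downFrom⁺; ∈-downFrom⁻; ∈-filter⁺; ∈-filter⁻; ∈-concatMap⁺; ∈-concatMap⁻)
open import Data.List.Relation.Binary.Disjoint.Propositional using (Disjoint)
open import Data.List.Relation.Unary.All as All using (All)
open import Data.List.Relation.Unary.Any as Any using (Any; here; there)
open import Data.List.Relation.Unary.All.Properties using () renaming (map⁺ to All-map⁺)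
open import Data.List.Relation.Unary.Any.Properties using (lookup-index) renaming (map⁺ to Any-map⁺)
open import Data.List.Relation.Unary.AllPairs using ([]; _∷_)
open import Data.List.Relation.Unary.Unique.Propositional using (Unique)
import Data.List.Relation.Unary.Unique.Propositional.Properties as Unique
open import Data.Product using (∃; ∃₂; _×_; _,_; proj₁; proj₂)
open import Data.Sum using (_⊎_; inj₁; inj₂)
open import Data.Empty using (⊥-elim)
open import Function using (_∘_; _⇔_; mk⇔; Equivalence)
import Function.Properties.Equivalence as ⇔
open import Relation.Nullary using (¬_; yes; no)
open import Relation.Binary.PropositionalEquality

open Equivalence using (to; from)

m<n⇒[m+kn]%n≡m : ∀ {m n} k .{{_ : NonZero n}} → m < n → (m + k * n) % n ≡ m
m<n⇒[m+kn]%n≡m {m} {n} k m<n = trans ([m+kn]%n≡m%n m k n) (m<n⇒m%n≡m m<n)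

m<n⇒[m+kn]/n≡k : ∀ {m n} k .{{_ : NonZero n}} → m < n → (m + k * n) / n ≡ k
m<n⇒[m+kn]/n≡k {m} {n} k m<n = begin
  (m + k * n) / n    ≡⟨ +-distrib-/ m (k * n) remainders<n ⟩
  m / n + k * n / n  ≡⟨ cong₂ _+_ (m<n⇒m/n≡0 m<n) (m*n/n≡m k n) ⟩
  k                  ∎
  where
  open ≡-Reasoning
  remainders<n : m % n + k * n % n < n
  remainders<n = subst (_< n) (sym (trans (cong₂ _+_ (m<n⇒m%n≡m m<n) (m*n%n≡0 k n)) (+-identityʳ m))) m<n

divMod-injective : ∀ {d r r′ q q′} .{{_ : NonZero d}} → r < d → r′ < d →
                   r + q * d ≡ r′ + q′ * d → r ≡ r′ × q ≡ q′
divMod-injective {d} {r} {r′} {q} {q′} r<d r′<d eq =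
    trans (sym (m<n⇒[m+kn]%n≡m q r<d)) (trans (cong (_% d) eq) (m<n⇒[m+kn]%n≡m q′ r′<d))
  , trans (sym (m<n⇒[m+kn]/n≡k q r<d)) (trans (cong (_/ d) eq) (m<n⇒[m+kn]/n≡k q′ r′<d))

m*n≤o⇔m≤o/n : ∀ m n o .{{_ : NonZero n}} → m * n ≤ o ⇔ m ≤ o / n
m*n≤o⇔m≤o/n m n o = mk⇔
  (λ le → subst (_≤ o / n) (m*n/n≡m m n) (/-monoˡ-≤ n le))
  (λ le → ≤-trans (*-monoˡ-≤ n le) (m/n*n≤m o n))

<ceilDiv⇔*< : ∀ p m k → p < ceilDiv m (suc k) ⇔ p * suc k < m
<ceilDiv⇔*< p m k = mk⇔
  (λ lt → +-cancelʳ-≤ k (suc (p * suc k)) m (subst (_≤ m + k) shift (from scaled lt)))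
  (λ lt → to scaled (subst (_≤ m + k) (sym shift) (+-monoˡ-≤ k lt)))
  where
  scaled : suc p * suc k ≤ m + k ⇔ suc p ≤ (m + k) / suc k
  scaled = m*n≤o⇔m≤o/n (suc p) (suc k) (m + k)
  shift : suc p * suc k ≡ suc (p * suc k) + k
  shift = cong suc (+-comm k (p * suc k))

ceilDiv[m+kn]≡1+k : ∀ {m n} k .{{_ : NonZero n}} → 0 < m → m ≤ n → ceilDiv (m + k * n) n ≡ suc k
ceilDiv[m+kn]≡1+k {suc m} {suc n} k _ (s≤s m≤n) =
  trans (cong (_/ suc n) (shift m k n)) (m<n⇒[m+kn]/n≡k (suc k) (s≤s m≤n))
  where
  shift : ∀ m k n → suc m + k * suc n + n ≡ m + suc k * suc n
  shift = solve-∀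

∣m-n∣≡o⇒m≡n+o⊎n≡m+o : ∀ m n {o} → ∣ m - n ∣ ≡ o → m ≡ n + o ⊎ n ≡ m + o
∣m-n∣≡o⇒m≡n+o⊎n≡m+o m n refl with ≤-total n m
... | inj₁ n≤m = inj₁ (sym (trans (cong (n +_) (m≤n⇒∣n-m∣≡n∸m n≤m)) (m+[n∸m]≡n n≤m)))
... | inj₂ m≤n = inj₂ (sym (trans (cong (m +_) (m≤n⇒∣m-n∣≡n∸m m≤n)) (m+[n∸m]≡n m≤n)))

≡-mod⇒≡+* : ∀ {s t n} .{{_ : NonZero t}} → s ≤ t → t ≤ n → s % t ≡ n % t →
            ∃ λ a → n ≡ s + a * t
≡-mod⇒≡+* {s} {t} {n} s≤t t≤n s≡n with m≤n⇒m<n∨m≡n s≤t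
... | inj₁ s<t = n / t , trans (m≡m%n+[m/n]*n n t)
                   (cong (_+ n / t * t) (trans (sym s≡n) (m<n⇒m%n≡m s<t)))
... | inj₂ refl = (n ∸ t) / t , trans (m≡m%n+[m/n]*n n t)
                    (cong₂ (λ x y → x + y * t) (trans (sym s≡n) (n%n≡0 t)) (m/n≡1+[m∸n]/n t≤n))

sum-downFrom-const : ∀ (f : ℕ → ℕ) {a} t → (∀ {r} → r < t → f r ≡ a) →
                     sum (map f (downFrom t)) ≡ t * a
sum-downFrom-const f zero     _     = refl
sum-downFrom-const f (suc t) const = cong₂ _+_ (const ≤-refl) (sum-downFrom-const f t (const ∘ m<n⇒m<1+n))

sum-downFrom-+ : ∀ (f : ℕ → ℕ) d s →
                 sum (map f (downFrom (d + s))) ≡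
                 sum (map (f ∘ (_+ s)) (downFrom d)) + sum (map f (downFrom s))
sum-downFrom-+ f zero    s = refl
sum-downFrom-+ f (suc d) s = trans (cong (f (d + s) +_) (sum-downFrom-+ f d s)) (sym (+-assoc (f (d + s)) _ _))

sum-downFrom-split : ∀ (f : ℕ → ℕ) {s t a b} → s ≤ t →
                     (∀ {r} → r < s → f r ≡ a) → (∀ {r} → s ≤ r → r < t → f r ≡ b) →
                     sum (map f (downFrom t)) ≡ s * a + (t ∸ s) * b
sum-downFrom-split f {s} {t} {a} {b} s≤t head tail = begin
  sum (map f (downFrom t))
    ≡⟨ cong (sum ∘ map f ∘ downFrom) (sym (m∸n+n≡m s≤t)) ⟩
  sum (map f (downFrom (t ∸ s + s)))
    ≡⟨ sum-downFrom-+ f (t ∸ s) s ⟩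
  sum (map (f ∘ (_+ s)) (downFrom (t ∸ s))) + sum (map f (downFrom s))
    ≡⟨ cong₂ _+_ (sum-downFrom-const (f ∘ (_+ s)) (t ∸ s) tail′) (sum-downFrom-const f s head) ⟩
  (t ∸ s) * b + s * a
    ≡⟨ +-comm ((t ∸ s) * b) (s * a) ⟩
  s * a + (t ∸ s) * b ∎
  where
  open ≡-Reasoning
  tail′ : ∀ {r} → r < t ∸ s → f (r + s) ≡ b
  tail′ {r} r<t∸s = tail (m≤n+m s r) (subst (r + s <_) (m∸n+n≡m s≤t) (+-monoˡ-< s r<t∸s))

module _ {a b} {A : Set a} {B : Set b} where

  length-concatMap : ∀ (f : A → List B) xs → length (concatMap f xs) ≡ sum (map (length ∘ f) xs)
  length-concatMap f []       = refl
  length-concatMap f (x ∷ xs) = trans (length-++ (f x)) (cong (length (f x) +_) (length-concatMap f xs))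

  concatMap-unique : ∀ {f : A → List B} (key : B → A) {xs} → Unique xs →
                     (∀ {x} → x ∈ xs → Unique (f x)) →
                     (∀ {x y} → x ∈ xs → y ∈ f x → key y ≡ x) →
                     Unique (concatMap f xs)
  concatMap-unique key [] _ _ = []
  concatMap-unique {f} key {x ∷ xs} (x∉xs ∷ xs!) f! keyed =
    Unique.++⁺ (f! (here refl)) (concatMap-unique key xs! (f! ∘ there) (keyed ∘ there)) disjoint
    where
    disjoint : Disjoint (f x) (concatMap f xs)
    disjoint (y∈fx , y∈rest) with x′ , x′∈xs , y∈fx′ ← find (∈-concatMap⁻ f y∈rest) =
      All.lookup x∉xs x′∈xs (trans (sym (keyed (here refl) y∈fx)) (keyed (there x′∈xs) y∈fx′))

module _ {a} {A : Set a} where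

  lookup-injective : ∀ {xs : List A} → Unique xs → ∀ {i j} → lookup xs i ≡ lookup xs j → i ≡ j
  lookup-injective (_ ∷ _)    {Fin.zero}  {Fin.zero}  _  = refl
  lookup-injective (x∉xs ∷ _) {Fin.zero}  {Fin.suc j} eq = ⊥-elim (All.lookup x∉xs (∈-lookup j) eq)
  lookup-injective (x∉xs ∷ _) {Fin.suc i} {Fin.zero}  eq = ⊥-elim (All.lookup x∉xs (∈-lookup i) (sym eq))
  lookup-injective (_ ∷ xs!)  {Fin.suc i} {Fin.suc j} eq = cong Fin.suc (lookup-injective xs! eq)

  -- Pigeonhole: send each element of W to the position of a member of 𝒞 containing it.
  length≤length-of-cover : ∀ (W : List A) (𝒞 : List (List A)) → Unique W →
    (∀ {w} → w ∈ W → Any (w ∈_) 𝒞) →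
    (∀ {C x y} → C ∈ 𝒞 → x ∈ C → y ∈ C → x ∈ W → y ∈ W → x ≡ y) →
    length W ≤ length 𝒞
  length≤length-of-cover W 𝒞 W! covered sparse = injective⇒≤ slot-injective
    where
    slot : Fin (length W) → Fin (length 𝒞)
    slot i = Any.index (covered (∈-lookup i))
    slot-injective : ∀ {i j} → slot i ≡ slot j → i ≡ j
    slot-injective {i} {j} eq = lookup-injective W! (sparse (∈-lookup (slot i))
      (lookup-index (covered (∈-lookup i)))
      (subst (λ c → lookup W j ∈ lookup 𝒞 c) (sym eq) (lookup-index (covered (∈-lookup j))))
      (∈-lookup i) (∈-lookup j))

∈-multiples⁻ : ∀ {t k d} → d ∈ multiples t k → ∃ λ j → j < k × d ≡ suc j * t
∈-multiples⁻ {t} d∈ with j , j∈ , refl ← ∈-map⁻ (λ j → suc j * t) d∈ =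
  j , ∈-upTo⁻ j∈ , refl

∣m*t-n*t∣∈multiples : ∀ {t k m n} → m ≤ k → n ≤ k → m ≢ n →
                      ∣ m * t - n * t ∣ ∈ multiples t k
∣m*t-n*t∣∈multiples {t} {k} {m} {n} m≤k n≤k m≢n with ∣ m - n ∣ in eq
... | zero  = ⊥-elim (m≢n (∣m-n∣≡0⇒m≡n eq))
... | suc j = subst (_∈ multiples t k) (trans (cong (_* t) (sym eq)) (*-distribʳ-∣-∣ t m n))
                (∈-map⁺ (λ j → suc j * t) (∈-upTo⁺ j<k))
  where
  j<k : j < k
  j<k = subst (_≤ k) eq (≤-trans (∣m-n∣≤m⊔n m n) (⊔-lub m≤k n≤k))

module ToeplitzMultiples (t k n : ℕ) .{{_ : NonZero t}} where

  -- Every vertex is uniquely point r q with r < t: column r, row q.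
  point : ℕ → ℕ → ℕ
  point r q = suc (r + q * t)

  point-+ : ∀ r q j → point r q + j * t ≡ point r (j + q)
  point-+ r q j = shift r q j t
    where
    shift : ∀ r q j t → suc (r + q * t) + j * t ≡ suc (r + (j + q) * t)
    shift = solve-∀

  witness : ℕ → ℕ → ℕ
  witness r p = point r (p * suc k)

  -- Witness rows are multiples of k + 1, and adjacency within a column needs a row gap in 1 … k.
  witness-gap : ∀ {r r′ p p′ j} → r < t → r′ < t → j < k →
                witness r p ≢ witness r′ p′ + suc j * t
  witness-gap {r} {r′} {p} {p′} {j} r<t r′<t j<k eq = 0≢1+n (begin
    0                             ≡⟨ sym (m*n%n≡0 p (suc k)) ⟩
    p * suc k % suc k             ≡⟨ cong (_% suc k) rows ⟩
    (suc j + p′ * suc k) % suc k  ≡⟨ m<n⇒[m+kn]%n≡m p′ (s≤s j<k) ⟩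
    suc j                         ∎)
    where
    open ≡-Reasoning
    rows : p * suc k ≡ suc j + p′ * suc k
    rows = proj₂ (divMod-injective r<t r′<t (suc-injective (trans eq (point-+ r′ (p′ * suc k) (suc j)))))

  witnesses-nonadjacent : ∀ {r r′ p p′} → r < t → r′ < t →
                          ¬ ToeplitzAdj (multiples t k) (witness r p) (witness r′ p′)
  witnesses-nonadjacent {r} {r′} {p} {p′} r<t r′<t (_ , d∈)
    with j , j<k , d≡ ← ∈-multiples⁻ d∈
    with ∣m-n∣≡o⇒m≡n+o⊎n≡m+o (witness r p) (witness r′ p′) d≡
  ... | inj₁ x≡ = witness-gap {r} {r′} {p} {p′} r<t r′<t j<k x≡
  ... | inj₂ y≡ = witness-gap {r′} {r} {p′} {p} r′<t r<t j<k y≡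

  window : ℕ → List ℕ
  window w = filter (_≤? n) (map (λ j → w + j * t) (downFrom (suc k)))

  ∈-window⁺ : ∀ {w j} → j ≤ k → w + j * t ≤ n → w + j * t ∈ window w
  ∈-window⁺ {w} j≤k le =
    ∈-filter⁺ (_≤? n) (∈-map⁺ (λ j → w + j * t) (∈-downFrom⁺ (s≤s j≤k))) le

  ∈-window⁻ : ∀ {w x} → x ∈ window w → ∃ λ j → j ≤ k × x ≡ w + j * t × x ≤ n
  ∈-window⁻ {w} x∈
    with x∈ws , x≤n ← ∈-filter⁻ (_≤? n) {xs = map (λ j → w + j * t) (downFrom (suc k))} x∈
    with j , j∈ , refl ← ∈-map⁻ (λ j → w + j * t) {xs = downFrom (suc k)} x∈ws =
    j , ≤-pred (∈-downFrom⁻ j∈) , refl , x≤n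

  window-clique : ∀ {w} → 1 ≤ w → IsClique n (multiples t k) (window w)
  window-clique {w} 1≤w = All.tabulate vertex , adjacent
    where
    vertex : ∀ {x} → x ∈ window w → Vertex n x
    vertex x∈ with j , _ , refl , x≤n ← ∈-window⁻ {w} x∈ = ≤-trans 1≤w (m≤m+n w (j * t)) , x≤n
    adjacent : ∀ {x y} → x ∈ window w → y ∈ window w → x ≢ y → ToeplitzAdj (multiples t k) x y
    adjacent x∈ y∈ x≢y
      with a , a≤k , refl , _ ← ∈-window⁻ {w} x∈ | b , b≤k , refl , _ ← ∈-window⁻ {w} y∈ =
      x≢y , subst (_∈ multiples t k) (sym (∣m+n-m+o∣≡∣n-o∣ w (a * t) (b * t)))
              (∣m*t-n*t∣∈multiples a≤k b≤k (x≢y ∘ cong (λ c → w + c * t)))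

  columnSize : ℕ → ℕ
  columnSize r = suc ((n ∸ suc r) / t)

  point≤n⇔<columnSize : ∀ {r q} → r < n → point r q ≤ n ⇔ q < columnSize r
  point≤n⇔<columnSize {r} {q} r<n = mk⇔
    (λ le → s≤s (to scaled (m+n≤o⇒m≤o∸n (q * t) (subst (_≤ n) reorder le))))
    (λ { (s≤s le) → subst (_≤ n) (sym reorder) (m≤o∸n⇒m+n≤o (q * t) r<n (from scaled le)) })
    where
    scaled : q * t ≤ n ∸ suc r ⇔ q ≤ (n ∸ suc r) / t
    scaled = m*n≤o⇔m≤o/n q t (n ∸ suc r)
    reorder : point r q ≡ q * t + suc r
    reorder = trans (cong suc (+-comm r (q * t))) (sym (+-suc (q * t) r))

  witnessCount : ℕ → ℕ
  witnessCount r = ceilDiv (columnSize r) (suc k)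

  witness≤n⇔<witnessCount : ∀ {r p} → r < n → witness r p ≤ n ⇔ p < witnessCount r
  witness≤n⇔<witnessCount {r} {p} r<n =
    ⇔.trans (point≤n⇔<columnSize r<n) (⇔.sym (<ceilDiv⇔*< p (columnSize r) k))

  column : ℕ → List ℕ
  column r = map (witness r) (downFrom (witnessCount r))

  witnesses : List ℕ
  witnesses = concatMap column (downFrom t)

  ∈-witnesses⁺ : ∀ {r p} → r < t → p < witnessCount r → witness r p ∈ witnesses
  ∈-witnesses⁺ {r} r<t p<c =
    ∈-concatMap⁺ column {xs = downFrom t}
      (lose (∈-downFrom⁺ r<t) (∈-map⁺ (witness r) (∈-downFrom⁺ p<c)))

  ∈-witnesses⁻ : ∀ {x} → x ∈ witnesses →
                 ∃₂ λ r p → r < t × p < witnessCount r × x ≡ witness r p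
  ∈-witnesses⁻ x∈ with r , r∈ , x∈col ← find (∈-concatMap⁻ column {xs = downFrom t} x∈)
                  with p , p∈ , refl ← ∈-map⁻ (witness r) {xs = downFrom (witnessCount r)} x∈col =
    r , p , ∈-downFrom⁻ r∈ , ∈-downFrom⁻ p∈ , refl

  witnesses-unique : Unique witnesses
  witnesses-unique = concatMap-unique residue (Unique.downFrom⁺ t) column-unique residue-column
    where
    residue : ℕ → ℕ
    residue x = (x ∸ 1) % t
    residue-column : ∀ {r x} → r ∈ downFrom t → x ∈ column r → residue x ≡ r
    residue-column {r} r∈ x∈
      with p , _ , refl ← ∈-map⁻ (witness r) {xs = downFrom (witnessCount r)} x∈ =
      m<n⇒[m+kn]%n≡m (p * suc k) (∈-downFrom⁻ r∈)
    column-unique : ∀ {r} → r ∈ downFrom t → Unique (column r)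
    column-unique {r} r∈ = Unique.map⁺ witness-injective (Unique.downFrom⁺ (witnessCount r))
      where
      r<t = ∈-downFrom⁻ r∈
      witness-injective : ∀ {p p′} → witness r p ≡ witness r p′ → p ≡ p′
      witness-injective {p} {p′} eq =
        *-cancelʳ-≡ p p′ (suc k) (proj₂ (divMod-injective r<t r<t (suc-injective eq)))

  length-column : ∀ r → length (column r) ≡ witnessCount r
  length-column r =
    trans (length-map (witness r) (downFrom (witnessCount r))) (length-downFrom (witnessCount r))

  columnSize≡1+ : ∀ {r e q} → n ∸ suc r ≡ e + q * t → e < t → columnSize r ≡ suc q
  columnSize≡1+ {q = q} eq e<t = cong suc (trans (cong (_/ t) eq) (m<n⇒[m+kn]/n≡k q e<t))

  columnSize-head : ∀ {s a r} → n ≡ s + a * t → s ≤ t → r < s → columnSize r ≡ ceilDiv n t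
  columnSize-head {s} {a} {r} n≡ s≤t r<s = begin
    columnSize r           ≡⟨ columnSize≡1+ (trans (cong (_∸ suc r) n≡) (+-∸-comm (a * t) r<s)) e<t ⟩
    suc a                  ≡⟨ sym (ceilDiv[m+kn]≡1+k a (≤-<-trans z≤n r<s) s≤t) ⟩
    ceilDiv (s + a * t) t  ≡⟨ cong (λ m → ceilDiv m t) (sym n≡) ⟩
    ceilDiv n t            ∎
    where
    open ≡-Reasoning
    e<t : s ∸ suc r < t
    e<t = <-≤-trans (∸-monoʳ-< {s} {suc r} {0} (s≤s z≤n) r<s) s≤t

  columnSize-tail : ∀ {s a r} → n ≡ s + a * t → t ≤ n → s ≤ r → r < t → columnSize r ≡ n / t
  columnSize-tail {s} {zero} {r} n≡ t≤n s≤r r<t =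
    ⊥-elim (<⇒≱ (<-≤-trans r<t t≤n) (subst (_≤ r) (sym (trans n≡ (+-identityʳ s))) s≤r))
  columnSize-tail {s} {suc a} {r} n≡ t≤n s≤r r<t =
    trans (columnSize≡1+ (trans (cong (_∸ suc r) n≡′) (+-∸-comm (a * t) 1+r≤s+t)) e<t)
          (sym (trans (cong (_/ t) n≡) (m<n⇒[m+kn]/n≡k (suc a) (≤-<-trans s≤r r<t))))
    where
    n≡′ : n ≡ (s + t) + a * t
    n≡′ = trans n≡ (sym (+-assoc s t (a * t)))
    1+r≤s+t : suc r ≤ s + t
    1+r≤s+t = ≤-trans r<t (m≤n+m t s)
    e<t : s + t ∸ suc r < t
    e<t = +-cancelʳ-< (suc r) (s + t ∸ suc r) t (begin-strict
      s + t ∸ suc r + suc r  ≡⟨ m∸n+n≡m 1+r≤s+t ⟩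
      s + t                  ≤⟨ +-monoˡ-≤ t s≤r ⟩
      r + t                  <⟨ +-monoˡ-< t ≤-refl ⟩
      suc r + t              ≡⟨ +-comm (suc r) t ⟩
      t + suc r              ∎)
      where open ≤-Reasoning

  module _ (t≤n : t ≤ n) where

    witness-vertex : ∀ {x} → x ∈ witnesses → Vertex n x
    witness-vertex x∈ with r , p , r<t , p<c , refl ← ∈-witnesses⁻ x∈ =
      s≤s z≤n , from (witness≤n⇔<witnessCount (<-≤-trans r<t t≤n)) p<c

    windows : List (List ℕ)
    windows = map window witnesses

    windows-clique : All (IsClique n (multiples t k)) windows
    windows-clique = All-map⁺ (All.tabulate (λ x∈ → window-clique (proj₁ (witness-vertex x∈))))

    -- With v - 1 = r + q t and q = j + p (k + 1), v is j rows below witness r p.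
    windows-cover : ∀ v → Vertex n v → Any (v ∈_) windows
    windows-cover (suc V) (_ , v≤n) =
      Any-map⁺ (lose (∈-witnesses⁺ {r} {p} r<t
                       (to (witness≤n⇔<witnessCount (<-≤-trans r<t t≤n)) w≤n))
                     (subst (_∈ window (witness r p)) v≡
                       (∈-window⁺ (≤-pred (m%n<n q (suc k))) (subst (_≤ n) (sym v≡) v≤n))))
      where
      open ≡-Reasoning
      r = V % t
      q = V / t
      j = q % suc k
      p = q / suc k
      r<t : r < t
      r<t = m%n<n V t
      v≡ : witness r p + j * t ≡ suc V
      v≡ = begin
        witness r p + j * t       ≡⟨ point-+ r (p * suc k) j ⟩
        point r (j + p * suc k)   ≡⟨ cong (point r) (sym (m≡m%n+[m/n]*n q (suc k))) ⟩
        point r q                 ≡⟨ cong suc (sym (m≡m%n+[m/n]*n V t)) ⟩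
        suc V                     ∎
      w≤n : witness r p ≤ n
      w≤n = ≤-trans (m≤m+n (witness r p) (j * t)) (subst (_≤ n) (sym v≡) v≤n)

    witnesses-sparse : ∀ {C x y} → IsClique n (multiples t k) C → x ∈ C → y ∈ C →
                       x ∈ witnesses → y ∈ witnesses → x ≡ y
    witnesses-sparse {x = x} {y} (_ , adjacent) x∈C y∈C x∈ y∈ with x ≟ y
    ... | yes x≡y = x≡y
    ... | no x≢y with r , p , r<t , _ , refl ← ∈-witnesses⁻ x∈
                 with r′ , p′ , r′<t , _ , refl ← ∈-witnesses⁻ y∈ =
      ⊥-elim (witnesses-nonadjacent {r} {r′} {p} {p′} r<t r′<t (adjacent x∈C y∈C x≢y))

    θ-length-witnesses : ThetaV n (multiples t k) (length witnesses)
    θ-length-witnesses = (windows , (windows-clique , windows-cover) , length-map window witnesses) , minimal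
      where
      minimal : ∀ 𝒞 → IsCliqueCover n (multiples t k) 𝒞 → length witnesses ≤ length 𝒞
      minimal 𝒞 (cliques , covers) = length≤length-of-cover witnesses 𝒞 witnesses-unique
        (λ x∈ → covers _ (witness-vertex x∈))
        (λ C∈ → witnesses-sparse (All.lookup cliques C∈))

theorem10 : (t k n : ℕ) → .{{_ : NonZero t}} → 1 ≤ k →
    (2 * k ∸ 1) * t < n → k * t < n →
    (s : ℕ) → 1 ≤ s → s ≤ t → s % t ≡ n % t →
    ThetaV n (multiples t k)
      (s * ceilDiv (ceilDiv n t) (suc k) + (t ∸ s) * ceilDiv (n / t) (suc k))
theorem10 t k n 1≤k _ kt<n s _ s≤t s≡n =
  subst (ThetaV n (multiples t k)) count (θ-length-witnesses t≤n)
  where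
  open ToeplitzMultiples t k n
  open ≡-Reasoning
  t≤n : t ≤ n
  t≤n = ≤-trans (m≤n*m t k {{>-nonZero 1≤k}}) (<⇒≤ kt<n)
  a : ℕ
  a = proj₁ (≡-mod⇒≡+* s≤t t≤n s≡n)
  n≡ : n ≡ s + a * t
  n≡ = proj₂ (≡-mod⇒≡+* s≤t t≤n s≡n)
  length-column-head : ∀ {r} → r < s → length (column r) ≡ ceilDiv (ceilDiv n t) (suc k)
  length-column-head r<s =
    trans (length-column _) (cong (λ m → ceilDiv m (suc k)) (columnSize-head {a = a} n≡ s≤t r<s))
  length-column-tail : ∀ {r} → s ≤ r → r < t → length (column r) ≡ ceilDiv (n / t) (suc k)
  length-column-tail s≤r r<t =
    trans (length-column _) (cong (λ m → ceilDiv m (suc k)) (columnSize-tail {a = a} n≡ t≤n s≤r r<t))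
  count : length witnesses ≡ s * ceilDiv (ceilDiv n t) (suc k) + (t ∸ s) * ceilDiv (n / t) (suc k)
  count = begin
    length witnesses                          ≡⟨ length-concatMap column (downFrom t) ⟩
    sum (map (length ∘ column) (downFrom t))
      ≡⟨ sum-downFrom-split (length ∘ column) s≤t length-column-head length-column-tail ⟩
    s * ceilDiv (ceilDiv n t) (suc k) + (t ∸ s) * ceilDiv (n / t) (suc k) ∎
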